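{- Let $r$ be a complex number and $n\ge0$ an integer. Then, as polynomials in $x$, $$D_n^{(r)}(x)=D_n^{(r+1)}(x)+n(n-1)D_{n-2}^{(r+1)}(x)=\sum_{k=0}^{\lfloor n/2\rfloor}\binom{n}{2k}\binom{ -r}{k}(2k)!\,D_{n-2k}^{(0)}(x),$$ where the term $n(n-1)D_{n-2}^{(r+1)}(x)$ is interpreted as $0$ when $n<2$.
   Context: For a complex number $a$ and integer $k\ge0$, $\binom{a}{k}=a(a-1)\cdots(a-k+1)/k!$. The polynomials $D_n^{(r)}(x)$ are defined by $D_{ -1}^{(r)}(x)=0$, $D_0^{(r)}(x)=1$ and $D_{n+1}^{(r)}(x)=xD_n^{(r)}(x)-n(n+2r)D_{n-1}^{(r)}(x)$ for $n\ge0$. -}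

module Defs where

open import Level using (Level)
open import Data.Nat using (ℕ; zero; suc; ⌊_/2⌋; _∸_)
import Data.Nat as ℕ
open import Data.Nat.Combinatorics using (_C_; _P_)
open import Algebra.Bundles using (CommutativeRing)

module _ {c ℓ : Level} (R : CommutativeRing c ℓ) where
  open CommutativeRing R hiding (zero)

  ι : ℕ → Carrier
  ι zero    = 0#
  ι (suc n) = 1# + ι n

  -- D r x n = D_n^{(r)}(x):  D_0 = 1, D_1 = x (= x·D_0 − 0·D_{-1}),
  -- D_{m+2} = x·D_{m+1} − (m+1)(m+1+2r)·D_m
  D : Carrier → Carrier → ℕ → Carrier
  D r x zero = 1#
  D r x (suc zero) = x
  D r x (suc (suc m)) =
    x * D r x (suc m) - (ι (suc m) * (ι (suc m) + (r + r))) * D r x m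

  fall : Carrier → ℕ → Carrier
  fall a zero    = 1#
  fall a (suc k) = fall a k * (a - ι k)

  -- binom(a,k)·(2k)!  =  a(a−1)⋯(a−k+1) · (2k)!/k!   (no division needed)
  binomTimesFact2k : Carrier → ℕ → Carrier
  binomTimesFact2k a k = ι ((2 ℕ.* k) P k) * fall a k

  sumUpTo : (ℕ → Carrier) → ℕ → Carrier
  sumUpTo f zero    = f zero
  sumUpTo f (suc m) = sumUpTo f m + f (suc m)

  middle : Carrier → Carrier → ℕ → Carrier
  middle r x zero = D (r + 1#) x zero
  middle r x (suc zero) = D (r + 1#) x (suc zero)
  middle r x (suc (suc m)) =
    D (r + 1#) x (suc (suc m)) + (ι (suc (suc m)) * ι (suc m)) * D (r + 1#) x m

  rhsSum : Carrier → Carrier → ℕ → Carrier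
  rhsSum r x n =
    sumUpTo (λ k → ι (n C (2 ℕ.* k)) * binomTimesFact2k (- r) k * D 0# x (n ∸ 2 ℕ.* k)) ⌊ n /2⌋

-- D⁽ʳ⁾ is the only sequence f with f₀ = 1, f₁ = x and f_{m+2} + (m+1)(m+1+2r) f_m = x f_{m+1},
-- so it suffices to check this recurrence for both right-hand sides. For the middle expression
-- it is a polynomial identity once the recurrence of D⁽ʳ⁺¹⁾ has been used twice. For the sum,
-- the recurrence of D⁽⁰⁾ splits x times each summand into a term with raised and one with
-- lowered D⁽⁰⁾-index; after shifting the summation index the recurrence holds termwise, and the
-- coefficient identity behind it reduces to the absorption identities
-- (j+1)·C(n+1,j+1) = (n+1)·C(n,j) = (n+1−j)·C(n+1,j) and (2k+2)!/(k+1)! = 2(2k+1)·(2k)!/k!.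

{-# OPTIONS --safe #-}
module Submission where

open import Defs
open import Level using (Level)
open import Function using (_∘_)
open import Data.Nat as ℕ using (ℕ; zero; suc; _∸_; _≤_; _<_; s≤s; _≤?_; ⌊_/2⌋)
import Data.Nat.Properties as ℕ
open import Data.Nat.Combinatorics using (_C_; _P_; k>n⇒nCk≡0)
open import Data.Product using (_×_; _,_; proj₁)
open import Relation.Nullary using (yes; no)
open import Relation.Binary.PropositionalEquality as ≡ using (_≡_)
open import Algebra.Bundles using (CommutativeRing)

module BinomialIdentities where
  open import Data.Nat
  open import Data.Nat.Properties
  open import Data.Nat.Combinatorics using (nCk+nC[k+1]≡[n+1]C[k+1]; nC1≡n)
  open import Data.Nat.Combinatorics.Base using (_P′_)
  open import Data.Nat.Combinatorics.Specification using (nP′k≡n[n∸1P′k∸1])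
  open import Data.Nat.Solver using (module +-*-Solver)
  open import Data.Bool using (true; false; T)
  open import Relation.Binary.PropositionalEquality
  open import Relation.Nullary using (contradiction)
  open +-*-Solver
  open ≡-Reasoning

  [1+k]*[1+n]C[1+k]≡[1+n]*nCk : ∀ n k → suc k * (suc n C suc k) ≡ suc n * (n C k)
  [1+k]*[1+n]C[1+k]≡[1+n]*nCk zero    zero    = refl
  [1+k]*[1+n]C[1+k]≡[1+n]*nCk zero    (suc k) = begin
    suc (suc k) * (1 C suc (suc k))  ≡⟨ cong (suc (suc k) *_) (k>n⇒nCk≡0 {1} {suc (suc k)} (s≤s (s≤s z≤n))) ⟩
    suc (suc k) * 0                  ≡⟨ *-zeroʳ (suc (suc k)) ⟩
    0                                ≡⟨ cong (1 *_) (k>n⇒nCk≡0 {0} {suc k} (s≤s z≤n)) ⟨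
    1 * (0 C suc k)                  ∎
  [1+k]*[1+n]C[1+k]≡[1+n]*nCk (suc n) zero    =
    trans (*-identityˡ _) (trans (nC1≡n (suc (suc n))) (sym (*-identityʳ _)))
  [1+k]*[1+n]C[1+k]≡[1+n]*nCk (suc n) (suc k) = begin
    suc (suc k) * (suc (suc n) C suc (suc k))
      ≡⟨ cong (suc (suc k) *_) (nCk+nC[k+1]≡[n+1]C[k+1] (suc n) (suc k)) ⟨
    suc (suc k) * (a + b)
      ≡⟨ solve 3 (λ K A B → (con 1 :+ K) :* (A :+ B) := A :+ (K :* A :+ (con 1 :+ K) :* B))
                 refl (suc k) a b ⟩
    a + (suc k * a + suc (suc k) * b)
      ≡⟨ cong (a +_) (cong₂ _+_ ([1+k]*[1+n]C[1+k]≡[1+n]*nCk n k)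
                                ([1+k]*[1+n]C[1+k]≡[1+n]*nCk n (suc k))) ⟩
    a + (suc n * (n C k) + suc n * (n C suc k))
      ≡⟨ cong (a +_) (*-distribˡ-+ (suc n) (n C k) (n C suc k)) ⟨
    a + suc n * (n C k + n C suc k)
      ≡⟨ cong (λ z → a + suc n * z) (nCk+nC[k+1]≡[n+1]C[k+1] n k) ⟩
    suc (suc n) * a
      ∎
    where
    a b : ℕ
    a = suc n C suc k
    b = suc n C suc (suc k)

  [1+n∸k]*[1+n]Ck≡[1+n]*nCk : ∀ n k → (suc n ∸ k) * (suc n C k) ≡ suc n * (n C k)
  [1+n∸k]*[1+n]Ck≡[1+n]*nCk n zero    = refl
  [1+n∸k]*[1+n]Ck≡[1+n]*nCk n (suc k) = begin
    (n ∸ k) * a                                   ≡⟨ *-distribʳ-∸ a (suc n) (suc k) ⟩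
    suc n * a ∸ suc k * a                         ≡⟨ cong (_∸ suc k * a) split ⟩
    suc k * a + suc n * (n C suc k) ∸ suc k * a   ≡⟨ m+n∸m≡n (suc k * a) _ ⟩
    suc n * (n C suc k)                           ∎
    where
    a : ℕ
    a = suc n C suc k
    split : suc n * a ≡ suc k * a + suc n * (n C suc k)
    split = begin
      suc n * a
        ≡⟨ cong (suc n *_) (nCk+nC[k+1]≡[n+1]C[k+1] n k) ⟨
      suc n * (n C k + n C suc k)
        ≡⟨ *-distribˡ-+ (suc n) (n C k) (n C suc k) ⟩
      suc n * (n C k) + suc n * (n C suc k)
        ≡⟨ cong (_+ suc n * (n C suc k)) ([1+k]*[1+n]C[1+k]≡[1+n]*nCk n k) ⟨
      suc k * a + suc n * (n C suc k)
        ∎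

  nCk*[m∸k+k]≡nCk*m : ∀ {n m} k → n ≤ m → (n C k) * (m ∸ k + k) ≡ (n C k) * m
  nCk*[m∸k+k]≡nCk*m {n} {m} k n≤m with k ≤? n
  ... | yes k≤n = cong ((n C k) *_) (m∸n+n≡m (≤-trans k≤n n≤m))
  ... | no  k≰n = begin
    (n C k) * (m ∸ k + k)   ≡⟨ cong (_* (m ∸ k + k)) nCk≡0 ⟩
    0                       ≡⟨ cong (_* m) nCk≡0 ⟨
    (n C k) * m             ∎
    where
    nCk≡0 : n C k ≡ 0
    nCk≡0 = k>n⇒nCk≡0 (≰⇒> k≰n)

  nPk≡nP′k : ∀ {n k} → k ≤ n → n P k ≡ n P′ k
  nPk≡nP′k {n} {k} k≤n with k ≤ᵇ n in eq
  ... | true  = refl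
  ... | false = contradiction (≤⇒≤ᵇ k≤n) (subst T eq)

  [1+n∸k]*[1+n]P′k≡[1+n]*nP′k : ∀ n k → (suc n ∸ k) * (suc n P′ k) ≡ suc n * (n P′ k)
  [1+n∸k]*[1+n]P′k≡[1+n]*nP′k n zero    = refl
  [1+n∸k]*[1+n]P′k≡[1+n]*nP′k n (suc k) = begin
    (n ∸ k) * ((suc n ∸ k) * (suc n P′ k))
      ≡⟨ cong ((n ∸ k) *_) ([1+n∸k]*[1+n]P′k≡[1+n]*nP′k n k) ⟩
    (n ∸ k) * (suc n * (n P′ k))
      ≡⟨ solve 3 (λ A N P → A :* (N :* P) := N :* (A :* P)) refl (n ∸ k) (suc n) (n P′ k) ⟩
    suc n * ((n ∸ k) * (n P′ k))
      ∎

  [2+2k]P[1+k]≡2*[1+2k]*[2k]Pk : ∀ k → (2 * suc k) P suc k ≡ 2 * (suc (2 * k) * ((2 * k) P k))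
  [2+2k]P[1+k]≡2*[1+2k]*[2k]Pk k = begin
    (2 * suc k) P suc k                             ≡⟨ nPk≡nP′k (m≤n*m (suc k) 2) ⟩
    (2 * suc k) P′ suc k                            ≡⟨ cong (_P′ suc k) (*-suc 2 k) ⟩
    suc (suc (2 * k)) P′ suc k                      ≡⟨ nP′k≡n[n∸1P′k∸1] (suc (suc (2 * k))) (suc k) ⟩
    suc (suc (2 * k)) * q                           ≡⟨ cong (_* q) (*-suc 2 k) ⟨
    2 * suc k * q                                   ≡⟨ *-assoc 2 (suc k) q ⟩
    2 * (suc k * q)                                 ≡⟨ cong (λ z → 2 * (z * q)) [1+2k]∸k≡1+k ⟨
    2 * ((suc (2 * k) ∸ k) * q)                     ≡⟨ cong (2 *_) ([1+n∸k]*[1+n]P′k≡[1+n]*nP′k (2 * k) k) ⟩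
    2 * (suc (2 * k) * ((2 * k) P′ k))              ≡⟨ cong (λ z → 2 * (suc (2 * k) * z)) (nPk≡nP′k (m≤n*m k 2)) ⟨
    2 * (suc (2 * k) * ((2 * k) P k))               ∎
    where
    q : ℕ
    q = suc (2 * k) P′ k
    [1+2k]∸k≡1+k : suc (2 * k) ∸ k ≡ suc k
    [1+2k]∸k≡1+k = trans (cong (_∸ k) 1+2k≡k+[1+k]) (m+n∸m≡n k (suc k))
      where
      1+2k≡k+[1+k] : suc (2 * k) ≡ k + suc k
      1+2k≡k+[1+k] = trans (cong (λ z → suc (k + z)) (+-identityʳ k)) (sym (+-suc k k))

  [1+n]C[1+2k]+[1+n]C[2+2k]≡[2+n]C[2+2k] : ∀ n k →
    suc n C suc (2 * k) + suc n C (2 * suc k) ≡ suc (suc n) C (2 * suc k)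
  [1+n]C[1+2k]+[1+n]C[2+2k]≡[2+n]C[2+2k] n k =
    subst (λ j → suc n C suc (2 * k) + suc n C j ≡ suc (suc n) C j) (sym (*-suc 2 k))
          (nCk+nC[k+1]≡[n+1]C[k+1] (suc n) (suc (2 * k)))

  [1+n]C[1+2k]*[2+2k]P[1+k]≡2*[1+n]*nC2k*[2k]Pk : ∀ n k →
    (suc n C suc (2 * k)) * ((2 * suc k) P suc k) ≡ 2 * (suc n * (n C (2 * k)) * ((2 * k) P k))
  [1+n]C[1+2k]*[2+2k]P[1+k]≡2*[1+n]*nC2k*[2k]Pk n k = begin
    c * ((2 * suc k) P suc k)
      ≡⟨ cong (c *_) ([2+2k]P[1+k]≡2*[1+2k]*[2k]Pk k) ⟩
    c * (2 * (suc (2 * k) * p))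
      ≡⟨ solve 3 (λ C J P → C :* (con 2 :* (J :* P)) := con 2 :* (J :* C :* P)) refl c (suc (2 * k)) p ⟩
    2 * (suc (2 * k) * c * p)
      ≡⟨ cong (λ z → 2 * (z * p)) ([1+k]*[1+n]C[1+k]≡[1+n]*nCk n (2 * k)) ⟩
    2 * (suc n * (n C (2 * k)) * p)
      ∎
    where
    c p : ℕ
    c = suc n C suc (2 * k)
    p = (2 * k) P k

  n<2*[1+⌊n/2⌋] : ∀ n → n < 2 * suc ⌊ n /2⌋
  n<2*[1+⌊n/2⌋] zero          = s≤s z≤n
  n<2*[1+⌊n/2⌋] (suc zero)    = s≤s (s≤s z≤n)
  n<2*[1+⌊n/2⌋] (suc (suc n)) =
    ≤-trans (s≤s (s≤s (n<2*[1+⌊n/2⌋] n))) (≤-reflexive (sym (*-suc 2 (suc ⌊ n /2⌋))))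

open BinomialIdentities

-- The ring solver needs coefficients with computable equality, and ℤ maps into every
-- commutative ring. The optimised multiple makes ⟦ + 1 ⟧ℤ reduce to 1# itself.
module ℤ-Coefficients {ℓ₁ ℓ₂ : Level} (R : CommutativeRing ℓ₁ ℓ₂) where
  open import Data.Integer as ℤ using (ℤ; +_; -[1+_])
  import Data.Integer.Properties as ℤ
  open import Data.Maybe using (Maybe; just; nothing)
  open import Algebra.Solver.Ring.AlmostCommutativeRing
    using (fromCommutativeRing; _-Raw-AlmostCommutative⟶_)
  open CommutativeRing R
  open import Algebra.Properties.Semiring.Mult.TCOptimised semiring
    using (1+×; ×-homo-+; ×1-homo-*) renaming (_×_ to _×′_)
  open import Algebra.Properties.Ring ring using (-‿involutive; -‿distribˡ-*; -0#≈0#)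
  open import Algebra.Properties.AbelianGroup +-abelianGroup using (⁻¹-∙-comm)
  open import Relation.Binary.Reasoning.Setoid setoid

  ⟦_⟧ℤ : ℤ → Carrier
  ⟦ + n ⟧ℤ      = n ×′ 1#
  ⟦ -[1+ n ] ⟧ℤ = - (suc n ×′ 1#)

  ⟦⊖⟧ : ∀ m n → ⟦ m ℤ.⊖ n ⟧ℤ ≈ m ×′ 1# - n ×′ 1#
  ⟦⊖⟧ zero    zero    = sym (-‿inverseʳ 0#)
  ⟦⊖⟧ zero    (suc n) = sym (+-identityˡ _)
  ⟦⊖⟧ (suc m) zero    = sym (trans (+-congˡ -0#≈0#) (+-identityʳ _))
  ⟦⊖⟧ (suc m) (suc n) = begin
    ⟦ suc m ℤ.⊖ suc n ⟧ℤ              ≡⟨ ≡.cong ⟦_⟧ℤ (ℤ.[1+m]⊖[1+n]≡m⊖n m n) ⟩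
    ⟦ m ℤ.⊖ n ⟧ℤ                      ≈⟨ ⟦⊖⟧ m n ⟩
    m ×′ 1# - n ×′ 1#                 ≈⟨ [c+a]-[c+b]≈a-b 1# (m ×′ 1#) (n ×′ 1#) ⟨
    (1# + m ×′ 1#) - (1# + n ×′ 1#)   ≈⟨ +-cong (1+× m 1#) (-‿cong (1+× n 1#)) ⟨
    suc m ×′ 1# - suc n ×′ 1#         ∎
    where
    [c+a]-[c+b]≈a-b : ∀ c a b → (c + a) - (c + b) ≈ a - b
    [c+a]-[c+b]≈a-b c a b = begin
      (c + a) - (c + b)         ≈⟨ +-cong refl (⁻¹-∙-comm c b) ⟨
      (c + a) + (- c + - b)     ≈⟨ +-cong (+-comm c a) refl ⟩
      (a + c) + (- c + - b)     ≈⟨ +-assoc a c _ ⟩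
      a + (c + (- c + - b))     ≈⟨ +-cong refl (+-assoc c (- c) (- b)) ⟨
      a + ((c - c) + - b)       ≈⟨ +-cong refl (+-cong (-‿inverseʳ c) refl) ⟩
      a + (0# + - b)            ≈⟨ +-cong refl (+-identityˡ (- b)) ⟩
      a - b                     ∎

  ⟦+⟧ : ∀ i j → ⟦ i ℤ.+ j ⟧ℤ ≈ ⟦ i ⟧ℤ + ⟦ j ⟧ℤ
  ⟦+⟧ (+ m)      (+ n)      = ×-homo-+ 1# m n
  ⟦+⟧ (+ m)      -[1+ n ]   = ⟦⊖⟧ m (suc n)
  ⟦+⟧ -[1+ m ]   (+ n)      = trans (⟦⊖⟧ n (suc m)) (+-comm _ _)
  ⟦+⟧ -[1+ m ]   -[1+ n ]   = begin
    - (suc (suc (m ℕ.+ n)) ×′ 1#)       ≡⟨ ≡.cong (λ k → - (suc k ×′ 1#)) (ℕ.+-suc m n) ⟨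
    - ((suc m ℕ.+ suc n) ×′ 1#)         ≈⟨ -‿cong (×-homo-+ 1# (suc m) (suc n)) ⟩
    - (suc m ×′ 1# + suc n ×′ 1#)       ≈⟨ ⁻¹-∙-comm _ _ ⟨
    - (suc m ×′ 1#) + - (suc n ×′ 1#)   ∎

  ⟦-⟧ : ∀ i → ⟦ ℤ.- i ⟧ℤ ≈ - ⟦ i ⟧ℤ
  ⟦-⟧ (+ zero)  = sym -0#≈0#
  ⟦-⟧ (+ suc n) = refl
  ⟦-⟧ -[1+ n ]  = sym (-‿involutive _)

  ⟦+*⟧ : ∀ m j → ⟦ + m ℤ.* j ⟧ℤ ≈ m ×′ 1# * ⟦ j ⟧ℤ
  ⟦+*⟧ zero    j = sym (zeroˡ _)
  ⟦+*⟧ (suc m) j = begin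
    ⟦ + suc m ℤ.* j ⟧ℤ               ≡⟨ ≡.cong ⟦_⟧ℤ (ℤ.suc-* (+ m) j) ⟩
    ⟦ j ℤ.+ + m ℤ.* j ⟧ℤ             ≈⟨ ⟦+⟧ j (+ m ℤ.* j) ⟩
    ⟦ j ⟧ℤ + ⟦ + m ℤ.* j ⟧ℤ          ≈⟨ +-cong (sym (*-identityˡ _)) (⟦+*⟧ m j) ⟩
    1# * ⟦ j ⟧ℤ + m ×′ 1# * ⟦ j ⟧ℤ   ≈⟨ distribʳ _ _ _ ⟨
    (1# + m ×′ 1#) * ⟦ j ⟧ℤ          ≈⟨ *-congʳ (1+× m 1#) ⟨
    suc m ×′ 1# * ⟦ j ⟧ℤ             ∎

  ⟦*⟧ : ∀ i j → ⟦ i ℤ.* j ⟧ℤ ≈ ⟦ i ⟧ℤ * ⟦ j ⟧ℤ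
  ⟦*⟧ (+ m)    j = ⟦+*⟧ m j
  ⟦*⟧ -[1+ m ] j = begin
    ⟦ -[1+ m ] ℤ.* j ⟧ℤ         ≡⟨ ≡.cong ⟦_⟧ℤ (ℤ.neg-distribˡ-* (+ suc m) j) ⟨
    ⟦ ℤ.- (+ suc m ℤ.* j) ⟧ℤ    ≈⟨ ⟦-⟧ (+ suc m ℤ.* j) ⟩
    - ⟦ + suc m ℤ.* j ⟧ℤ        ≈⟨ -‿cong (⟦+*⟧ (suc m) j) ⟩
    - (suc m ×′ 1# * ⟦ j ⟧ℤ)    ≈⟨ -‿distribˡ-* _ _ ⟩
    - (suc m ×′ 1#) * ⟦ j ⟧ℤ    ∎

  ⟦⟧ℤ-homomorphism : ℤ.+-*-rawRing -Raw-AlmostCommutative⟶ fromCommutativeRing R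
  ⟦⟧ℤ-homomorphism = record
    { ⟦_⟧    = ⟦_⟧ℤ
    ; +-homo = ⟦+⟧
    ; *-homo = ⟦*⟧
    ; -‿homo = ⟦-⟧
    ; 0-homo = refl
    ; 1-homo = refl
    }

  ⟦⟧ℤ-≟ : ∀ i j → Maybe (⟦ i ⟧ℤ ≈ ⟦ j ⟧ℤ)
  ⟦⟧ℤ-≟ i j with i ℤ.≟ j
  ... | yes ≡.refl = just refl
  ... | no _       = nothing

  open import Algebra.Solver.Ring ℤ.+-*-rawRing (fromCommutativeRing R) ⟦⟧ℤ-homomorphism ⟦⟧ℤ-≟ public

module _ {ℓ₁ ℓ₂ : Level} (R : CommutativeRing ℓ₁ ℓ₂) where
  open import Data.Integer using (+_)
  open CommutativeRing R hiding (zero)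
  open ℤ-Coefficients R using (solve; _:=_; con; _:+_; _:*_; _:-_; :-_; Polynomial)
  open import Relation.Binary.Reasoning.Setoid setoid

  ι-homo-+ : ∀ m n → ι R (m ℕ.+ n) ≈ ι R m + ι R n
  ι-homo-+ zero    n = sym (+-identityˡ _)
  ι-homo-+ (suc m) n = trans (+-congˡ (ι-homo-+ m n)) (sym (+-assoc _ _ _))

  ι-homo-* : ∀ m n → ι R (m ℕ.* n) ≈ ι R m * ι R n
  ι-homo-* zero    n = sym (zeroˡ _)
  ι-homo-* (suc m) n = begin
    ι R (n ℕ.+ m ℕ.* n)           ≈⟨ ι-homo-+ n (m ℕ.* n) ⟩
    ι R n + ι R (m ℕ.* n)         ≈⟨ +-cong (sym (*-identityˡ _)) (ι-homo-* m n) ⟩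
    1# * ι R n + ι R m * ι R n    ≈⟨ distribʳ _ _ _ ⟨
    (1# + ι R m) * ι R n          ∎

  ι-cong : ∀ {m n} → m ≡ n → ι R m ≈ ι R n
  ι-cong e = reflexive (≡.cong (ι R) e)

  coeff : Carrier → ℕ → Carrier
  coeff r n = ι R n * (ι R n + (r + r))

  D-recurrence : ∀ r x m →
    D R r x (2 ℕ.+ m) + coeff r (suc m) * D R r x m ≈ x * D R r x (suc m)
  D-recurrence r x m =
    solve 2 (λ a b → (a :- b) :+ b := a) refl (x * D R r x (suc m)) (coeff r (suc m) * D R r x m)

  D-unique : ∀ {r x} (f : ℕ → Carrier) → f 0 ≈ 1# → f 1 ≈ x →
    (∀ m → f (2 ℕ.+ m) + coeff r (suc m) * f m ≈ x * f (suc m)) →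
    ∀ n → D R r x n ≈ f n
  D-unique {r} {x} f f₀ f₁ f-rec n = proj₁ (D≈f-twice n)
    where
    D≈f-twice : ∀ n → D R r x n ≈ f n × D R r x (suc n) ≈ f (suc n)
    D≈f-twice zero    = sym f₀ , sym f₁
    D≈f-twice (suc n) with D≈f-twice n
    ... | e₀ , e₁ = e₁ , (begin
      x * D R r x (suc n) - w * D R r x n  ≈⟨ +-cong (*-congˡ e₁) (-‿cong (*-congˡ e₀)) ⟩
      x * f (suc n) - w * f n              ≈⟨ +-congʳ (f-rec n) ⟨
      (f (2 ℕ.+ n) + w * f n) - w * f n    ≈⟨ solve 2 (λ a b → (a :+ b) :- b := a) refl (f (2 ℕ.+ n)) (w * f n) ⟩
      f (2 ℕ.+ n)                          ∎)
      where
      w : Carrier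
      w = coeff r (suc n)

  -- If ⟦ μ ⟧ = ι R m then ⟦ ι⁺ j μ ⟧ is definitionally ι R (j + m), so solver equations built
  -- from ι⁺, ι⁰ and coeff⁺ match the unfolded definitions of D and middle.
  ι⁺ : ∀ {k} → ℕ → Polynomial k → Polynomial k
  ι⁺ zero    p = p
  ι⁺ (suc j) p = con (+ 1) :+ ι⁺ j p

  ι⁰ : ∀ {k} → ℕ → Polynomial k
  ι⁰ j = ι⁺ j (con (+ 0))

  coeff⁺ : ∀ {k} → Polynomial k → Polynomial k → Polynomial k
  coeff⁺ ρ ν = ν :* (ν :+ (ρ :+ ρ))

  middle-recurrence : ∀ r x m →
    middle R r x (2 ℕ.+ m) + coeff r (suc m) * middle R r x m ≈ x * middle R r x (suc m)
  middle-recurrence r x zero = begin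
    (E 2 + (ι R 2 * ι R 1) * 1#) + coeff r 1 * 1#
      ≈⟨ solve 2 (λ e ρ → (e :+ (ι⁰ 2 :* ι⁰ 1) :* con (+ 1)) :+ coeff⁺ ρ (ι⁰ 1) :* con (+ 1)
                         := e :+ coeff⁺ (ρ :+ con (+ 1)) (ι⁰ 1) :* con (+ 1)) refl (E 2) r ⟩
    E 2 + coeff (r + 1#) 1 * 1#
      ≈⟨ D-recurrence (r + 1#) x 0 ⟩
    x * x ∎
    where
    E : ℕ → Carrier
    E = D R (r + 1#) x
  middle-recurrence r x (suc zero) = begin
    (E 3 + (ι R 3 * ι R 2) * x) + coeff r 2 * x
      ≈⟨ solve 3 (λ e X ρ → (e :+ (ι⁰ 3 :* ι⁰ 2) :* X) :+ coeff⁺ ρ (ι⁰ 2) :* X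
                         := (e :+ coeff⁺ (ρ :+ con (+ 1)) (ι⁰ 2) :* X) :+ (ι⁰ 2 :* ι⁰ 1) :* X)
                 refl (E 3) x r ⟩
    (E 3 + coeff (r + 1#) 2 * x) + (ι R 2 * ι R 1) * x
      ≈⟨ +-congʳ (D-recurrence (r + 1#) x 1) ⟩
    x * E 2 + (ι R 2 * ι R 1) * x
      ≈⟨ solve 2 (λ X e → X :* e :+ (ι⁰ 2 :* ι⁰ 1) :* X := X :* (e :+ (ι⁰ 2 :* ι⁰ 1) :* con (+ 1)))
                 refl x (E 2) ⟩
    x * (E 2 + (ι R 2 * ι R 1) * 1#) ∎
    where
    E : ℕ → Carrier
    E = D R (r + 1#) x
  middle-recurrence r x (suc (suc m)) = begin
    (E (4 ℕ.+ m) + (ι R (4 ℕ.+ m) * ι R (3 ℕ.+ m)) * E (2 ℕ.+ m))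
      + coeff r (3 ℕ.+ m) * (E (2 ℕ.+ m) + (ι R (2 ℕ.+ m) * ι R (1 ℕ.+ m)) * E m)
      ≈⟨ solve 5 (λ e₄ e₂ e₀ ρ μ →
           (e₄ :+ (ι⁺ 4 μ :* ι⁺ 3 μ) :* e₂) :+ coeff⁺ ρ (ι⁺ 3 μ) :* (e₂ :+ (ι⁺ 2 μ :* ι⁺ 1 μ) :* e₀)
           := (e₄ :+ coeff⁺ (ρ :+ con (+ 1)) (ι⁺ 3 μ) :* e₂)
              :+ (ι⁺ 3 μ :* ι⁺ 2 μ) :* (e₂ :+ coeff⁺ (ρ :+ con (+ 1)) (ι⁺ 1 μ) :* e₀))
           refl (E (4 ℕ.+ m)) (E (2 ℕ.+ m)) (E m) r (ι R m) ⟩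
    (E (4 ℕ.+ m) + coeff (r + 1#) (3 ℕ.+ m) * E (2 ℕ.+ m))
      + (ι R (3 ℕ.+ m) * ι R (2 ℕ.+ m)) * (E (2 ℕ.+ m) + coeff (r + 1#) (1 ℕ.+ m) * E m)
      ≈⟨ +-cong (D-recurrence (r + 1#) x (2 ℕ.+ m)) (*-congˡ (D-recurrence (r + 1#) x m)) ⟩
    x * E (3 ℕ.+ m) + (ι R (3 ℕ.+ m) * ι R (2 ℕ.+ m)) * (x * E (1 ℕ.+ m))
      ≈⟨ solve 4 (λ X e₃ e₁ μ → X :* e₃ :+ (ι⁺ 3 μ :* ι⁺ 2 μ) :* (X :* e₁)
                              := X :* (e₃ :+ (ι⁺ 3 μ :* ι⁺ 2 μ) :* e₁))
                 refl x (E (3 ℕ.+ m)) (E (1 ℕ.+ m)) (ι R m) ⟩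
    x * (E (3 ℕ.+ m) + (ι R (3 ℕ.+ m) * ι R (2 ℕ.+ m)) * E (1 ℕ.+ m)) ∎
    where
    E : ℕ → Carrier
    E = D R (r + 1#) x

  module _ {f g : ℕ → Carrier} where

    sumUpTo-cong : (∀ k → f k ≈ g k) → ∀ M → sumUpTo R f M ≈ sumUpTo R g M
    sumUpTo-cong f≈g zero    = f≈g zero
    sumUpTo-cong f≈g (suc M) = +-cong (sumUpTo-cong f≈g M) (f≈g (suc M))

    sumUpTo-+ : ∀ M → sumUpTo R (λ k → f k + g k) M ≈ sumUpTo R f M + sumUpTo R g M
    sumUpTo-+ zero    = refl
    sumUpTo-+ (suc M) = trans (+-congʳ (sumUpTo-+ M))
      (solve 4 (λ a b c d → (a :+ b) :+ (c :+ d) := (a :+ c) :+ (b :+ d)) refl _ _ _ _)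

  *-distribˡ-sumUpTo : ∀ a f M → a * sumUpTo R f M ≈ sumUpTo R (λ k → a * f k) M
  *-distribˡ-sumUpTo a f zero    = refl
  *-distribˡ-sumUpTo a f (suc M) = trans (distribˡ _ _ _) (+-congʳ (*-distribˡ-sumUpTo a f M))

  sumUpTo-suc : ∀ f M → sumUpTo R f (suc M) ≈ f 0 + sumUpTo R (f ∘ suc) M
  sumUpTo-suc f zero    = refl
  sumUpTo-suc f (suc M) = trans (+-congʳ (sumUpTo-suc f M)) (+-assoc _ _ _)

  sumUpTo-extend : ∀ {f M N} → (∀ k → M < k → f k ≈ 0#) → M ≤ N → sumUpTo R f N ≈ sumUpTo R f M
  sumUpTo-extend {f} {M} f≈0 M≤N = go (ℕ.≤⇒≤′ M≤N)
    where
    go : ∀ {N} → M ℕ.≤′ N → sumUpTo R f N ≈ sumUpTo R f M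
    go ℕ.≤′-refl        = refl
    go (ℕ.≤′-step M≤′N) = trans (+-cong (go M≤′N) (f≈0 _ (s≤s (ℕ.≤′⇒≤ M≤′N)))) (+-identityʳ _)

  -- For j = suc n truncated subtraction sends all three indices to 0; the identity survives only
  -- because coeff r 0 = 0.
  D-recurrence-∸ : ∀ r x n j → j ≤ suc n →
    x * D R r x (suc n ∸ j) ≈ D R r x (2 ℕ.+ n ∸ j) + coeff r (suc n ∸ j) * D R r x (n ∸ j)
  D-recurrence-∸ r x n       zero          _           = sym (D-recurrence r x n)
  D-recurrence-∸ r x zero    (suc zero)    _           =
    solve 2 (λ X ρ → X :* con (+ 1) := X :+ coeff⁺ ρ (ι⁰ 0) :* con (+ 1)) refl x r
  D-recurrence-∸ r x zero    (suc (suc j)) (s≤s ())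
  D-recurrence-∸ r x (suc n) (suc j)       (s≤s j≤1+n) = D-recurrence-∸ r x n j j≤1+n

  binomial-term-vanishes : ∀ {n k} a y → n < k → ι R (n C k) * a * y ≈ 0#
  binomial-term-vanishes a y n<k =
    trans (*-congʳ (trans (*-congʳ (ι-cong (k>n⇒nCk≡0 n<k))) (zeroˡ a))) (zeroˡ y)

  -- Used with c = C(n+1,2k+1), q = (2k+2)!/(k+1)!, a = C(n,2k), p = (2k)!/k!, b = C(n+1,2k),
  -- m = n+1−2k, N = n+1, K = k and f = (−r)(−r−1)⋯(−r−k+1).
  coefficient-identity : ∀ r {c q a p m b N K f} →
    c * q ≈ ι R 2 * (N * a * p) →
    m * b ≈ N * a →
    a * m + a * (ι R 2 * K) ≈ a * N →
    c * (q * (f * (- r - K))) + N * (N + (r + r)) * (a * (p * f))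
      ≈ b * (p * f) * (m * (m + (0# + 0#)))
  coefficient-identity r {c} {q} {a} {p} {m} {b} {N} {K} {f} cq≈ mb≈ am≈ = begin
    c * (q * (f * (- r - K))) + N * (N + (r + r)) * (a * (p * f))
      ≈⟨ +-congʳ (*-assoc c q (f * (- r - K))) ⟨
    (c * q) * (f * (- r - K)) + N * (N + (r + r)) * (a * (p * f))
      ≈⟨ +-congʳ (*-congʳ cq≈) ⟩
    (ι R 2 * (N * a * p)) * (f * (- r - K)) + N * (N + (r + r)) * (a * (p * f))
      ≈⟨ solve 6 (λ N A P F ρ K′ →
           (ι⁰ 2 :* (N :* A :* P)) :* (F :* (:- ρ :- K′)) :+ N :* (N :+ (ρ :+ ρ)) :* (A :* (P :* F))
           := N :* (P :* F) :* (A :* N :- A :* (ι⁰ 2 :* K′))) refl N a p f r K ⟩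
    N * (p * f) * (a * N - a * (ι R 2 * K))
      ≈⟨ *-congˡ aN-a2K≈am ⟩
    N * (p * f) * (a * m)
      ≈⟨ solve 4 (λ N A P′ M → N :* P′ :* (A :* M) := P′ :* M :* (N :* A)) refl N a (p * f) m ⟩
    (p * f) * m * (N * a)
      ≈⟨ *-congˡ mb≈ ⟨
    (p * f) * m * (m * b)
      ≈⟨ solve 3 (λ P′ M B → P′ :* M :* (M :* B) := B :* P′ :* (M :* (M :+ (con (+ 0) :+ con (+ 0)))))
                 refl (p * f) m b ⟩
    b * (p * f) * (m * (m + (0# + 0#))) ∎
    where
    aN-a2K≈am : a * N - a * (ι R 2 * K) ≈ a * m
    aN-a2K≈am = trans (+-congʳ (sym am≈))
                      (solve 2 (λ u v → (u :+ v) :- v := u) refl (a * m) (a * (ι R 2 * K)))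

  module _ (r x : Carrier) where

    private
      G : ℕ → Carrier
      G = D R 0# x

      b : ℕ → Carrier
      b = binomTimesFact2k R (- r)

    rhsTerm : ℕ → ℕ → Carrier
    rhsTerm n k = ι R (n C (2 ℕ.* k)) * b k * G (n ∸ 2 ℕ.* k)

    upperTerm lowerTerm : ℕ → ℕ → Carrier
    upperTerm n k = ι R (suc n C (2 ℕ.* k)) * b k * G (2 ℕ.+ n ∸ 2 ℕ.* k)
    lowerTerm n k = ι R (suc n C (2 ℕ.* k)) * b k * (coeff 0# (suc n ∸ 2 ℕ.* k) * G (n ∸ 2 ℕ.* k))

    x*rhsTerm≈upperTerm+lowerTerm : ∀ n k → x * rhsTerm (suc n) k ≈ upperTerm n k + lowerTerm n k
    x*rhsTerm≈upperTerm+lowerTerm n k with 2 ℕ.* k ≤? suc n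
    ... | yes 2k≤1+n = begin
      x * (c * b k * G (suc n ∸ 2 ℕ.* k))
        ≈⟨ solve 4 (λ X C B g → X :* (C :* B :* g) := C :* B :* (X :* g))
                   refl x c (b k) (G (suc n ∸ 2 ℕ.* k)) ⟩
      c * b k * (x * G (suc n ∸ 2 ℕ.* k))
        ≈⟨ *-congˡ (D-recurrence-∸ 0# x n (2 ℕ.* k) 2k≤1+n) ⟩
      c * b k * (G (2 ℕ.+ n ∸ 2 ℕ.* k) + coeff 0# (suc n ∸ 2 ℕ.* k) * G (n ∸ 2 ℕ.* k))
        ≈⟨ distribˡ _ _ _ ⟩
      upperTerm n k + lowerTerm n k ∎
      where
      c : Carrier
      c = ι R (suc n C (2 ℕ.* k))
    ... | no 2k≰1+n = begin
      x * rhsTerm (suc n) k          ≈⟨ *-congˡ (binomial-term-vanishes _ _ 1+n<2k) ⟩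
      x * 0#                         ≈⟨ zeroʳ x ⟩
      0#                             ≈⟨ +-identityʳ 0# ⟨
      0# + 0#                        ≈⟨ +-cong (binomial-term-vanishes _ _ 1+n<2k) (binomial-term-vanishes _ _ 1+n<2k) ⟨
      upperTerm n k + lowerTerm n k  ∎
      where
      1+n<2k : suc n < 2 ℕ.* k
      1+n<2k = ℕ.≰⇒> 2k≰1+n

    lowerTerm-vanishes : ∀ n k → suc n ≤ 2 ℕ.* k → lowerTerm n k ≈ 0#
    lowerTerm-vanishes n k 1+n≤2k = trans (*-congˡ (trans (*-congʳ coeff≈0) (zeroˡ _))) (zeroʳ _)
      where
      coeff≈0 : coeff 0# (suc n ∸ 2 ℕ.* k) ≈ 0#
      coeff≈0 = trans (*-congʳ (ι-cong (ℕ.m≤n⇒m∸n≡0 1+n≤2k))) (zeroˡ _)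

    rhsTerm-coefficients : ∀ n k →
      ι R (suc n C suc (2 ℕ.* k)) * b (suc k) + coeff r (suc n) * (ι R (n C (2 ℕ.* k)) * b k)
        ≈ ι R (suc n C (2 ℕ.* k)) * b k * coeff 0# (suc n ∸ 2 ℕ.* k)
    rhsTerm-coefficients n k = coefficient-identity r cq≈ mb≈ am≈
      where
      A Q M : ℕ
      A = n C (2 ℕ.* k)
      Q = (2 ℕ.* k) P k
      M = suc n ∸ 2 ℕ.* k
      cq≈ : ι R (suc n C suc (2 ℕ.* k)) * ι R ((2 ℕ.* suc k) P suc k)
              ≈ ι R 2 * (ι R (suc n) * ι R A * ι R Q)
      cq≈ = begin
        ι R (suc n C suc (2 ℕ.* k)) * ι R ((2 ℕ.* suc k) P suc k)
          ≈⟨ ι-homo-* (suc n C suc (2 ℕ.* k)) _ ⟨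
        ι R ((suc n C suc (2 ℕ.* k)) ℕ.* ((2 ℕ.* suc k) P suc k))
          ≈⟨ ι-cong ([1+n]C[1+2k]*[2+2k]P[1+k]≡2*[1+n]*nC2k*[2k]Pk n k) ⟩
        ι R (2 ℕ.* (suc n ℕ.* A ℕ.* Q))
          ≈⟨ trans (ι-homo-* 2 (suc n ℕ.* A ℕ.* Q))
                   (*-congˡ (trans (ι-homo-* (suc n ℕ.* A) Q) (*-congʳ (ι-homo-* (suc n) A)))) ⟩
        ι R 2 * (ι R (suc n) * ι R A * ι R Q) ∎
      mb≈ : ι R M * ι R (suc n C (2 ℕ.* k)) ≈ ι R (suc n) * ι R A
      mb≈ = trans (sym (ι-homo-* M (suc n C (2 ℕ.* k))))
                  (trans (ι-cong ([1+n∸k]*[1+n]Ck≡[1+n]*nCk n (2 ℕ.* k))) (ι-homo-* (suc n) A))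
      am≈ : ι R A * ι R M + ι R A * (ι R 2 * ι R k) ≈ ι R A * ι R (suc n)
      am≈ = begin
        ι R A * ι R M + ι R A * (ι R 2 * ι R k)  ≈⟨ distribˡ _ _ _ ⟨
        ι R A * (ι R M + ι R 2 * ι R k)          ≈⟨ *-congˡ (+-congˡ (ι-homo-* 2 k)) ⟨
        ι R A * (ι R M + ι R (2 ℕ.* k))          ≈⟨ *-congˡ (ι-homo-+ M (2 ℕ.* k)) ⟨
        ι R A * ι R (M ℕ.+ 2 ℕ.* k)              ≈⟨ ι-homo-* A (M ℕ.+ 2 ℕ.* k) ⟨
        ι R (A ℕ.* (M ℕ.+ 2 ℕ.* k))              ≈⟨ ι-cong (nCk*[m∸k+k]≡nCk*m (2 ℕ.* k) (ℕ.n≤1+n n)) ⟩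
        ι R (A ℕ.* suc n)                        ≈⟨ ι-homo-* A (suc n) ⟩
        ι R A * ι R (suc n)                      ∎

    rhsTerm-recurrence : ∀ n k →
      rhsTerm (2 ℕ.+ n) (suc k) + coeff r (suc n) * rhsTerm n k ≈ upperTerm n (suc k) + lowerTerm n k
    rhsTerm-recurrence n k = begin
      ι R E * b (suc k) * g′ + w * (ι R A * b k * g)
        ≈⟨ +-congʳ (*-cong (*-congʳ pascal) g′≈g) ⟩
      (ι R C₁ + ι R C₂) * b (suc k) * g + w * (ι R A * b k * g)
        ≈⟨ solve 7 (λ c₁ c₂ β′ γ ω α β → (c₁ :+ c₂) :* β′ :* γ :+ ω :* (α :* β :* γ)
                                       := c₂ :* β′ :* γ :+ (c₁ :* β′ :+ ω :* (α :* β)) :* γ)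
                   refl (ι R C₁) (ι R C₂) (b (suc k)) g w (ι R A) (b k) ⟩
      ι R C₂ * b (suc k) * g + (ι R C₁ * b (suc k) + w * (ι R A * b k)) * g
        ≈⟨ +-congˡ (*-congʳ (rhsTerm-coefficients n k)) ⟩
      ι R C₂ * b (suc k) * g + ι R B * b k * coeff 0# (suc n ∸ 2 ℕ.* k) * g
        ≈⟨ +-cong (*-congˡ (sym g′≈g)) (*-assoc _ _ _) ⟩
      upperTerm n (suc k) + lowerTerm n k ∎
      where
      A B C₁ C₂ E : ℕ
      A  = n C (2 ℕ.* k)
      B  = suc n C (2 ℕ.* k)
      C₁ = suc n C suc (2 ℕ.* k)
      C₂ = suc n C (2 ℕ.* suc k)
      E  = suc (suc n) C (2 ℕ.* suc k)
      w g g′ : Carrier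
      w  = coeff r (suc n)
      g  = G (n ∸ 2 ℕ.* k)
      g′ = G (2 ℕ.+ n ∸ 2 ℕ.* suc k)
      g′≈g : g′ ≈ g
      g′≈g = reflexive (≡.cong (λ j → G (2 ℕ.+ n ∸ j)) (ℕ.*-suc 2 k))
      pascal : ι R E ≈ ι R C₁ + ι R C₂
      pascal = trans (ι-cong (≡.sym ([1+n]C[1+2k]+[1+n]C[2+2k]≡[2+n]C[2+2k] n k))) (ι-homo-+ C₁ C₂)

    rhsTerm-vanishes : ∀ n k → n < 2 ℕ.* k → rhsTerm n k ≈ 0#
    rhsTerm-vanishes n k = binomial-term-vanishes (b k) (G (n ∸ 2 ℕ.* k))

    rhsSum-extend : ∀ n K → ⌊ n /2⌋ ≤ K → sumUpTo R (rhsTerm n) K ≈ rhsSum R r x n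
    rhsSum-extend n K = sumUpTo-extend λ k ⌊n/2⌋<k →
      rhsTerm-vanishes n k (ℕ.<-≤-trans (n<2*[1+⌊n/2⌋] n) (ℕ.*-monoʳ-≤ 2 ⌊n/2⌋<k))

    sumUpTo-rhsTerm-recurrence : ∀ n K → suc n ≤ 2 ℕ.* suc K →
      sumUpTo R (rhsTerm (2 ℕ.+ n)) (suc K) + coeff r (suc n) * sumUpTo R (rhsTerm n) K
        ≈ x * sumUpTo R (rhsTerm (suc n)) (suc K)
    sumUpTo-rhsTerm-recurrence n K 1+n≤2[1+K] = begin
      S (rhsTerm (2 ℕ.+ n)) (suc K) + w * S (rhsTerm n) K
        ≈⟨ +-cong (sumUpTo-suc (rhsTerm (2 ℕ.+ n)) K) (*-distribˡ-sumUpTo w (rhsTerm n) K) ⟩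
      (upperTerm n 0 + S (rhsTerm (2 ℕ.+ n) ∘ suc) K) + S (λ k → w * rhsTerm n k) K
        ≈⟨ +-assoc _ _ _ ⟩
      upperTerm n 0 + (S (rhsTerm (2 ℕ.+ n) ∘ suc) K + S (λ k → w * rhsTerm n k) K)
        ≈⟨ +-congˡ (sumUpTo-+ K) ⟨
      upperTerm n 0 + S (λ k → rhsTerm (2 ℕ.+ n) (suc k) + w * rhsTerm n k) K
        ≈⟨ +-congˡ (sumUpTo-cong (rhsTerm-recurrence n) K) ⟩
      upperTerm n 0 + S (λ k → upperTerm n (suc k) + lowerTerm n k) K
        ≈⟨ +-congˡ (sumUpTo-+ K) ⟩
      upperTerm n 0 + (S (upperTerm n ∘ suc) K + S (lowerTerm n) K)
        ≈⟨ +-assoc _ _ _ ⟨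
      (upperTerm n 0 + S (upperTerm n ∘ suc) K) + S (lowerTerm n) K
        ≈⟨ +-cong (sumUpTo-suc (upperTerm n) K) lower-pad ⟨
      S (upperTerm n) (suc K) + S (lowerTerm n) (suc K)
        ≈⟨ sumUpTo-+ (suc K) ⟨
      S (λ k → upperTerm n k + lowerTerm n k) (suc K)
        ≈⟨ sumUpTo-cong (λ k → x*rhsTerm≈upperTerm+lowerTerm n k) (suc K) ⟨
      S (λ k → x * rhsTerm (suc n) k) (suc K)
        ≈⟨ *-distribˡ-sumUpTo x (rhsTerm (suc n)) (suc K) ⟨
      x * S (rhsTerm (suc n)) (suc K) ∎
      where
      S : (ℕ → Carrier) → ℕ → Carrier
      S = sumUpTo R
      w : Carrier
      w = coeff r (suc n)
      lower-pad : S (lowerTerm n) (suc K) ≈ S (lowerTerm n) K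
      lower-pad = trans (+-congˡ (lowerTerm-vanishes n (suc K) 1+n≤2[1+K])) (+-identityʳ _)

    rhsSum-recurrence : ∀ n →
      rhsSum R r x (2 ℕ.+ n) + coeff r (suc n) * rhsSum R r x n ≈ x * rhsSum R r x (suc n)
    rhsSum-recurrence n = begin
      rhsSum R r x (2 ℕ.+ n) + coeff r (suc n) * rhsSum R r x n
        ≈⟨ sumUpTo-rhsTerm-recurrence n ⌊ n /2⌋ (n<2*[1+⌊n/2⌋] n) ⟩
      x * sumUpTo R (rhsTerm (suc n)) (suc ⌊ n /2⌋)
        ≈⟨ *-congˡ (rhsSum-extend (suc n) _ (ℕ.⌊n/2⌋-mono (ℕ.n≤1+n (suc n)))) ⟩
      x * rhsSum R r x (suc n) ∎

    rhsSum₀ : rhsSum R r x 0 ≈ 1#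
    rhsSum₀ = solve 0 (ι⁰ 1 :* (ι⁰ 1 :* con (+ 1)) :* con (+ 1) := con (+ 1)) refl

    rhsSum₁ : rhsSum R r x 1 ≈ x
    rhsSum₁ = solve 1 (λ X → ι⁰ 1 :* (ι⁰ 1 :* con (+ 1)) :* X := X) refl x

theorem3p6 : {c ℓ : Level} (R : CommutativeRing c ℓ) (r x : CommutativeRing.Carrier R) (n : ℕ) →
    CommutativeRing._≈_ R (D R r x n) (middle R r x n)
      × CommutativeRing._≈_ R (middle R r x n) (rhsSum R r x n)
theorem3p6 R r x n = D≈middle , trans (sym D≈middle) D≈rhsSum
  where
  open CommutativeRing R using (_≈_; refl; sym; trans)
  D≈middle : D R r x n ≈ middle R r x n
  D≈middle = D-unique R (middle R r x) refl refl (middle-recurrence R r x) n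
  D≈rhsSum : D R r x n ≈ rhsSum R r x n
  D≈rhsSum = D-unique R (rhsSum R r x) (rhsSum₀ R r x) (rhsSum₁ R r x) (rhsSum-recurrence R r x) n
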